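{- Let $q$ be a prime power. In $\Lambda_{5,q}$ there is a cycle of type $(u_1,v_1,\dots,u_5,v_5)$ with $v_1+v_5=0$ if and only if there exist $b,c,r\in\mathbb{F}_q^*$ with $c\notin\{ -b,-2b\}$ such that $v_1=-2b-c$, $v_2=b$, $v_3=c$, $v_4=-b-c$, $v_5=2b+c$ and $u_1=cr$, $u_2=-(b+c)r$, $u_3=(2b+c)r$, $u_4=-(2b+c)r$, $u_5=br$.
   Context: For a prime power $q$ and integer $k\ge2$, $\Lambda_{k,q}$ is the bipartite graph with vertex set $L_k\cup R_k$ (regarded as disjoint), where $L_k$ is the set of vectors $[l]=(l_0,\dots,l_k)\in\mathbb{F}_q^{k+1}$ with $l_1=l_2$ and $R_k$ the set of vectors $\langle r\rangle=(r_0,\dots,r_k)\in\mathbb{F}_q^{k+1}$ with $r_1=0$; edges join only $L_k$ to $R_k$, and $[l]\sim\langle r\rangle$ iff for every $2\le i\le k$: $l_i+r_i=r_0l_{i-2}$ if $i\equiv2,3\pmod4$, and $l_i+r_i=l_0r_{i-2}$ if $i\equiv0,1\pmod4$. A cycle of length $2n$ through the edge joining the two all-zero vectors is written $[l^{(1)}],\langle r^{(1)}\rangle,\dots,[l^{(n)}],\langle r^{(n)}\rangle$ (distinct vertices, consecutive ones adjacent, $\langle r^{(n)}\rangle\sim[l^{(1)}]$) with $[l^{(1)}]$ and $\langle r^{(1)}\rangle$ the all-zero vectors. Put $x_i=l^{(i)}_0$, $y_i=r^{(i)}_0$ ($1\le i\le n$), $x_{n+1}=y_{n+1}=0$, $u_i=x_{i+1}-x_i$,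 $v_i=y_{i+1}-y_i$; the tuple $(u_1,v_1,\dots,u_n,v_n)$ is the type of the cycle, and "there is a cycle of type $\epsilon$" means such a cycle with type $\epsilon$ exists. -}

module Defs where

open import Level using (Level; _⊔_) renaming (suc to lsuc)
open import Algebra.Bundles using (CommutativeRing)
open import Data.Nat as ℕ using (ℕ; zero; suc; _<_; _≤_; _%_; _<ᵇ_)
open import Data.Nat.Properties using (_<?_; <-trans; ≤-trans; n<1+n)
open import Data.Fin as Fin using (Fin; toℕ; fromℕ<)
open import Relation.Binary.PropositionalEquality using (_≡_)
open import Data.Bool using (true; false)
open import Data.Product using (Σ; ∃; _×_; _,_)
open import Relation.Nullary using (¬_; yes; no)
open import Relation.Binary using (Decidable)

record FiniteField (c ℓ : Level) : Set (lsuc (c ⊔ ℓ)) where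
  field
    commRing : CommutativeRing c ℓ
  open CommutativeRing commRing public
  field
    1≉0      : ¬ (1# ≈ 0#)
    inverse  : ∀ x → ¬ (x ≈ 0#) → Σ Carrier λ y → x * y ≈ 1#
    _≟_      : Decidable _≈_
    size     : ℕ
    enum     : Fin size → Carrier
    enum-surj : ∀ x → Σ (Fin size) λ i → enum i ≈ x

module Lambda {c ℓ} (F : FiniteField c ℓ) where
  open FiniteField F

  Vect : ℕ → Set c
  Vect k = Fin (suc k) → Carrier

  at : ∀ {k} → Vect k → (i : ℕ) → i < suc k → Carrier
  at v i p = v (fromℕ< p)

  _≋_ : ∀ {k} → Vect k → Vect k → Set ℓ
  v ≋ w = ∀ i → v i ≈ w i

  zeroV : ∀ {k} → Vect k
  zeroV _ = 0#

  -- L_k : l_1 = l_2 ;  R_k : r_1 = 0   (for k ≥ 2)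
  InL : ∀ {k} → Vect k → 2 ≤ k → Set ℓ
  InL l p = at l 1 (ℕ.s≤s (≤-trans (ℕ.s≤s ℕ.z≤n) p)) ≈ at l 2 (ℕ.s≤s p)

  InR : ∀ {k} → Vect k → 2 ≤ k → Set ℓ
  InR r p = at r 1 (ℕ.s≤s (≤-trans (ℕ.s≤s ℕ.z≤n) p)) ≈ 0#

  -- adjacency condition at index i = j + 2 (2 ≤ i ≤ k):
  --   if i ≡ 2,3 (mod 4) (i.e. j ≡ 0,1 mod 4): l_i + r_i = r_0 l_{i-2}
  --   if i ≡ 0,1 (mod 4) (i.e. j ≡ 2,3 mod 4): l_i + r_i = l_0 r_{i-2}
  AdjAt : ∀ {k} → Vect k → Vect k → (j : ℕ) → suc (suc j) < suc k → Set ℓ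
  AdjAt l r j p with j % 4 <ᵇ 2
  ... | true  = at l (suc (suc j)) p + at r (suc (suc j)) p
                  ≈ at r 0 (ℕ.s≤s ℕ.z≤n) * at l j (<-trans (n<1+n j) (<-trans (n<1+n (suc j)) p))
  ... | false = at l (suc (suc j)) p + at r (suc (suc j)) p
                  ≈ at l 0 (ℕ.s≤s ℕ.z≤n) * at r j (<-trans (n<1+n j) (<-trans (n<1+n (suc j)) p))

  Adj : ∀ {k} → Vect k → Vect k → Set ℓ
  Adj {k} l r = ∀ j (p : suc (suc j) < suc k) → AdjAt l r j p

  ext : ∀ {a} {A : Set a} {n} → (Fin n → A) → A → ℕ → A
  ext {n = n} f d m with m <? n
  ... | yes p = f (fromℕ< p)
  ... | no _  = d

  -- (n = suc m.)  A cycle of length 2n in Λ_{k,q} through the edge joining the two all-zero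
  -- vectors: [l⁽¹⁾], ⟨r⁽¹⁾⟩, …, [l⁽ⁿ⁾], ⟨r⁽ⁿ⁾⟩ (indexed 0..n-1 here),
  -- with [l⁽¹⁾] = ⟨r⁽¹⁾⟩ = 0, all vertices distinct, consecutive ones adjacent,
  -- and ⟨r⁽ⁿ⁾⟩ ∼ [l⁽¹⁾].
  record IsCycle (k : ℕ) (k≥2 : 2 ≤ k) (m : ℕ) (ls rs : Fin (suc m) → Vect k) : Set (c ⊔ ℓ) where
    field
      inL      : ∀ i → InL (ls i) k≥2
      inR      : ∀ i → InR (rs i) k≥2
      l-zero   : ls Fin.zero ≋ zeroV
      r-zero   : rs Fin.zero ≋ zeroV
      l-dist   : ∀ i j → ¬ (i ≡ j) → ¬ (ls i ≋ ls j)
      r-dist   : ∀ i j → ¬ (i ≡ j) → ¬ (rs i ≋ rs j)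
      adj-lr   : ∀ i → Adj (ls i) (rs i)
      adj-rl   : ∀ i → Adj (ext ls (ls Fin.zero) (suc (toℕ i))) (rs i)

  -- "there is a cycle of type (u_1,v_1,…,u_n,v_n)" in Λ_{k,q}, n = suc m;
  -- u, v are indexed 0..n-1; x_i = l⁽ⁱ⁾_0, y_i = r⁽ⁱ⁾_0, x_{n+1} = y_{n+1} = 0,
  -- u_i = x_{i+1} - x_i, v_i = y_{i+1} - y_i.
  HasCycleOfType : (k : ℕ) → 2 ≤ k → (m : ℕ) → (u v : Fin (suc m) → Carrier) → Set (c ⊔ ℓ)
  HasCycleOfType k k≥2 m u v =
    Σ (Fin (suc m) → Vect k) λ ls → Σ (Fin (suc m) → Vect k) λ rs →
      IsCycle k k≥2 m ls rs ×
      (∀ i → u i ≈ ext (λ j → ls j Fin.zero) 0# (suc (toℕ i)) - ls i Fin.zero) ×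
      (∀ i → v i ≈ ext (λ j → rs j Fin.zero) 0# (suc (toℕ i)) - rs i Fin.zero)

2≤5 : 2 ≤ 5
2≤5 = ℕ.s≤s (ℕ.s≤s ℕ.z≤n)

-- In Λ₅ a vertex is determined by any one of its neighbours together with its own 0-coordinate.
-- Hence a 10-cycle through the zero edge is the walk determined by the 0-coordinates x₂,…,x₅ and
-- y₂,…,y₅ of its vertices, and it closes up exactly when the last four coordinates of its tenth
-- vertex vanish: four polynomial equations. Given y₅ = y₂ and the inequalities x₃ ≠ x₄ ≠ x₅ ≠ 0,
-- 0 ≠ y₂ ≠ y₃ ≠ y₄ ≠ y₂ forced by the distinctness of neighbouring vertices, elimination yields
-- y₂ = y₃ + y₄, x₅ = x₃, y₃x₃ + y₄x₄ = 0 and (y₃ + y₄)x₂ = (y₃ - y₄)(x₄ - x₃); for b = -y₄,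
-- c = y₄ - y₃ and r = x₅/y₄ this is precisely the stated type. Conversely, the walk with these
-- 0-coordinates closes up and has pairwise distinct vertices.
module Submission where

open import Defs
open import Data.Fin using (Fin; #_)
open import Data.Product using (Σ; _×_)
open import Relation.Nullary using (¬_)
open import Function.Bundles using (_⇔_)

open import Level using (0ℓ)
open import Algebra.Bundles using (CommutativeRing; RawRing)
open import Data.Nat as ℕ using (ℕ; zero; suc)
import Data.Nat.Properties as ℕ
open import Data.Integer as ℤ using (ℤ; +_; -[1+_]; _⊖_)
import Data.Integer.Properties as ℤ
open import Data.Sign as Sign using (Sign)
open import Data.Maybe using (Maybe; just; nothing)
open import Data.Fin as Fin using (toℕ; _<_)
open import Data.Fin.Patterns
open import Data.Fin.Properties using (<-cmp)
open import Data.Product using (_,_; proj₁; proj₂)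
open import Relation.Binary.Definitions using (tri<; tri≈; tri>)
open import Relation.Binary.PropositionalEquality as ≡ using (_≡_; _≢_)
open import Relation.Nullary using (yes; no; contradiction)
open import Function.Bundles using (mk⇔)

-- The ring solver can only compare coefficients that compute, which the elements of an abstract
-- ring do not; so identities are normalised with integer coefficients, mapped in by n ↦ n · 1#.
module IntegerRingSolver {c ℓ} (R : CommutativeRing c ℓ) where
  open CommutativeRing R
  open import Algebra.Properties.CommutativeSemigroup +-commutativeSemigroup using (interchange)
  open import Algebra.Properties.Ring ring
    using (-‿involutive; -0#≈0#; -‿distribˡ-*; -‿distribʳ-*; -‿+-comm)
  open import Algebra.Properties.Monoid.Mult.TCOptimised +-monoid
    using (×-homo-+; 1+×) renaming (_×_ to _·_)
  open import Algebra.Properties.Semiring.Mult.TCOptimised semiring using (×1-homo-*)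
  open import Algebra.Solver.Ring.AlmostCommutativeRing
    using (fromCommutativeRing; _-Raw-AlmostCommutative⟶_)
  open import Relation.Binary.Reasoning.Setoid setoid

  ι : ℕ → Carrier
  ι n = n · 1#

  ⟦_⟧ℤ : ℤ → Carrier
  ⟦ + n ⟧ℤ = ι n
  ⟦ -[1+ n ] ⟧ℤ = - ι (suc n)

  ⊖-homo : ∀ m n → ⟦ m ⊖ n ⟧ℤ ≈ ι m - ι n
  ⊖-homo zero zero = sym (-‿inverseʳ 0#)
  ⊖-homo zero (suc n) = sym (+-identityˡ _)
  ⊖-homo (suc m) zero = sym (trans (+-congˡ -0#≈0#) (+-identityʳ _))
  ⊖-homo (suc m) (suc n) = begin
    ⟦ suc m ⊖ suc n ⟧ℤ        ≡⟨ ≡.cong ⟦_⟧ℤ (ℤ.[1+m]⊖[1+n]≡m⊖n m n) ⟩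
    ⟦ m ⊖ n ⟧ℤ                ≈⟨ ⊖-homo m n ⟩
    ι m - ι n                 ≈⟨ +-identityˡ (ι m - ι n) ⟨
    0# + (ι m - ι n)          ≈⟨ +-congʳ (-‿inverseʳ 1#) ⟨
    (1# - 1#) + (ι m - ι n)   ≈⟨ interchange 1# (- 1#) (ι m) (- ι n) ⟩
    (1# + ι m) + (- 1# - ι n) ≈⟨ +-cong (1+× m 1#) (sym (-‿+-comm 1# (ι n))) ⟨
    ι (suc m) - (1# + ι n)    ≈⟨ +-congˡ (-‿cong (1+× n 1#)) ⟨
    ι (suc m) - ι (suc n)     ∎

  +-homo : ∀ i j → ⟦ i ℤ.+ j ⟧ℤ ≈ ⟦ i ⟧ℤ + ⟦ j ⟧ℤ
  +-homo -[1+ m ] -[1+ n ] = begin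
    - ι (suc (suc (m ℕ.+ n)))  ≡⟨ ≡.cong (λ k → - ι (suc k)) (ℕ.+-suc m n) ⟨
    - ι (suc m ℕ.+ suc n)      ≈⟨ -‿cong (×-homo-+ 1# (suc m) (suc n)) ⟩
    - (ι (suc m) + ι (suc n))  ≈⟨ -‿+-comm _ _ ⟨
    - ι (suc m) - ι (suc n)    ∎
  +-homo -[1+ m ] (+ n) = trans (⊖-homo n (suc m)) (+-comm _ _)
  +-homo (+ m) -[1+ n ] = ⊖-homo m (suc n)
  +-homo (+ m) (+ n) = ×-homo-+ 1# m n

  signed : Sign → Carrier → Carrier
  signed Sign.+ x = x
  signed Sign.- x = - x

  ◃-homo : ∀ s n → ⟦ s ℤ.◃ n ⟧ℤ ≈ signed s (ι n)
  ◃-homo Sign.+ zero = refl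
  ◃-homo Sign.+ (suc n) = refl
  ◃-homo Sign.- zero = sym -0#≈0#
  ◃-homo Sign.- (suc n) = refl

  *-homo : ∀ i j → ⟦ i ℤ.* j ⟧ℤ ≈ ⟦ i ⟧ℤ * ⟦ j ⟧ℤ
  *-homo (+ m) (+ n) = trans (◃-homo Sign.+ (m ℕ.* n)) (×1-homo-* m n)
  *-homo (+ m) -[1+ n ] =
    trans (◃-homo Sign.- (m ℕ.* suc n)) (trans (-‿cong (×1-homo-* m (suc n))) (-‿distribʳ-* _ _))
  *-homo -[1+ m ] (+ n) =
    trans (◃-homo Sign.- (suc m ℕ.* n)) (trans (-‿cong (×1-homo-* (suc m) n)) (-‿distribˡ-* _ _))
  *-homo -[1+ m ] -[1+ n ] = begin
    ⟦ Sign.+ ℤ.◃ (suc m ℕ.* suc n) ⟧ℤ  ≈⟨ ◃-homo Sign.+ (suc m ℕ.* suc n) ⟩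
    ι (suc m ℕ.* suc n)                ≈⟨ ×1-homo-* (suc m) (suc n) ⟩
    ι (suc m) * ι (suc n)              ≈⟨ -‿involutive _ ⟨
    - - (ι (suc m) * ι (suc n))        ≈⟨ -‿cong (-‿distribˡ-* _ _) ⟩
    - (- ι (suc m) * ι (suc n))        ≈⟨ -‿distribʳ-* _ _ ⟩
    - ι (suc m) * - ι (suc n)          ∎

  -‿homo : ∀ i → ⟦ ℤ.- i ⟧ℤ ≈ - ⟦ i ⟧ℤ
  -‿homo (+ zero) = sym -0#≈0#
  -‿homo (+ suc n) = refl
  -‿homo -[1+ n ] = sym (-‿involutive _)

  integerMorphism : ℤ.+-*-rawRing -Raw-AlmostCommutative⟶ fromCommutativeRing R
  integerMorphism = record
    { ⟦_⟧ = ⟦_⟧ℤ ; +-homo = +-homo ; *-homo = *-homo ; -‿homo = -‿homo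
    ; 0-homo = refl ; 1-homo = refl
    }

  _≟ℤ_ : ∀ i j → Maybe (⟦ i ⟧ℤ ≈ ⟦ j ⟧ℤ)
  i ≟ℤ j with i ℤ.≟ j
  ... | yes ≡.refl = just refl
  ... | no _ = nothing

  open import Algebra.Solver.Ring ℤ.+-*-rawRing (fromCommutativeRing R) integerMorphism _≟ℤ_ public

  polynomialRawRing : ℕ → RawRing 0ℓ 0ℓ
  polynomialRawRing n = record
    { Carrier = Polynomial n ; _≈_ = _≡_
    ; _+_ = _:+_ ; _*_ = _:*_ ; -_ = :-_ ; 0# = con (+ 0) ; 1# = con (+ 1)
    }

-- Stated over an arbitrary raw ring so that it can be instantiated both at a field and at the
-- solver's polynomial syntax: evaluating a polynomial built by these functions gives, by
-- computation, the same functions applied to the values, so the solver proves identities about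
-- coordinates of walks.
module Λ₅Paths {c ℓ} (R : RawRing c ℓ) where
  open RawRing R

  private
    infixl 6 _-_
    _-_ : Carrier → Carrier → Carrier
    x - y = x + - y

  Vertex : Set c
  Vertex = Fin 6 → Carrier

  vertex : (a₀ a₁ a₂ a₃ a₄ a₅ : Carrier) → Vertex
  vertex a₀ a₁ a₂ a₃ a₄ a₅ 0F = a₀
  vertex a₀ a₁ a₂ a₃ a₄ a₅ 1F = a₁
  vertex a₀ a₁ a₂ a₃ a₄ a₅ 2F = a₂
  vertex a₀ a₁ a₂ a₃ a₄ a₅ 3F = a₃
  vertex a₀ a₁ a₂ a₃ a₄ a₅ 4F = a₄
  vertex a₀ a₁ a₂ a₃ a₄ a₅ 5F = a₅

  -- The adjacency equations solved for the neighbour: rNeighbour l y is the only ⟨r⟩ ∼ [l] with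
  -- r₀ = y, and lNeighbour r x the only [l] ∼ ⟨r⟩ with l₀ = x.
  rNeighbour : Vertex → Carrier → Vertex
  rNeighbour l y = vertex y 0# r₂ r₃ (l 0F * r₂ - l 4F) (l 0F * r₃ - l 5F)
    where
    r₂ = y * l 0F - l 2F
    r₃ = y * l 1F - l 3F

  lNeighbour : Vertex → Carrier → Vertex
  lNeighbour r x = vertex x l₂ l₂ (r 0F * l₂ - r 3F) (x * r 2F - r 4F) (x * r 3F - r 5F)
    where
    l₂ = r 0F * x - r 2F

  -- pathL x y n and pathR x y n are the paper's [l⁽ⁿ⁺¹⁾] and ⟨r⁽ⁿ⁺¹⁾⟩; x 0 is not used.
  pathL pathR : (x y : ℕ → Carrier) → ℕ → Vertex
  pathL x y zero    = λ _ → 0#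
  pathL x y (suc n) = lNeighbour (pathR x y n) (x (suc n))
  pathR x y n       = rNeighbour (pathL x y n) (y n)

  -- cycleCoordinates a₂ a₃ a₄ a₅ n is the paper's a₍ₙ₊₁₎, with a₁ = a₆ = 0.
  cycleCoordinates : (a₂ a₃ a₄ a₅ : Carrier) → ℕ → Carrier
  cycleCoordinates a₂ a₃ a₄ a₅ 1 = a₂
  cycleCoordinates a₂ a₃ a₄ a₅ 2 = a₃
  cycleCoordinates a₂ a₃ a₄ a₅ 3 = a₄
  cycleCoordinates a₂ a₃ a₄ a₅ 4 = a₅
  cycleCoordinates a₂ a₃ a₄ a₅ _ = 0#

  -- The tenth vertex ⟨r⁽⁵⁾⟩ of the walk, for y₅ = y₂.
  closingVertex : (x₂ x₃ x₄ x₅ y₂ y₃ y₄ : Carrier) → Vertex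
  closingVertex x₂ x₃ x₄ x₅ y₂ y₃ y₄ =
    pathR (cycleCoordinates x₂ x₃ x₄ x₅) (cycleCoordinates y₂ y₃ y₄ y₂) 4

  standardX : (b c r : Carrier) → ℕ → Carrier
  standardX b c r = cycleCoordinates (c * r) (- (b * r)) ((b + c) * r) (- (b * r))

  standardY : (b c : Carrier) → ℕ → Carrier
  standardY b c = cycleCoordinates (- (b + b) - c) (- b - c) (- b) (- (b + b) - c)

  standardU : (b c r : Carrier) → Fin 5 → Carrier
  standardU b c r 0F = c * r
  standardU b c r 1F = - ((b + c) * r)
  standardU b c r 2F = ((b + b) + c) * r
  standardU b c r 3F = - (((b + b) + c) * r)
  standardU b c r 4F = b * r

  standardV : (b c : Carrier) → Fin 5 → Carrier
  standardV b c 0F = - (b + b) - c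
  standardV b c 1F = b
  standardV b c 2F = c
  standardV b c 3F = - b - c
  standardV b c 4F = (b + b) + c

module Λ₅ {a ℓ} (F : FiniteField a ℓ) where
  open FiniteField F
  open Lambda F
  open IntegerRingSolver commRing using (solve; _:=_; _:+_; _:*_; _:-_; :-_; con; polynomialRawRing)
  open Λ₅Paths rawRing
  module P {n} = Λ₅Paths (polynomialRawRing n)
  open import Algebra.Properties.Group +-group
    using () renaming (x∙y⁻¹≈ε⇒x≈y to x-y≈0⇒x≈y; x≈y⇒x∙y⁻¹≈ε to x≈y⇒x-y≈0)
  open import Algebra.Properties.Ring ring using (-‿involutive; -0#≈0#)
  open import Data.Vec.Functional.Relation.Binary.Equality.Setoid setoid using (≋-refl; ≋-sym; ≋-trans)
  open import Relation.Binary.Reasoning.Setoid setoid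

  ≈-by-difference : ∀ {x y z} → x - y ≈ z → z ≈ 0# → x ≈ y
  ≈-by-difference x-y≈z z≈0 = x-y≈0⇒x≈y _ _ (trans x-y≈z z≈0)

  ≉-by-difference : ∀ {x y z} → x - y ≈ z → z ≉ 0# → x ≉ y
  ≉-by-difference x-y≈z z≉0 x≈y = z≉0 (trans (sym x-y≈z) (x≈y⇒x-y≈0 x≈y))

  x≉y⇒x-y≉0 : ∀ {x y} → x ≉ y → x - y ≉ 0#
  x≉y⇒x-y≉0 x≉y x-y≈0 = x≉y (x-y≈0⇒x≈y _ _ x-y≈0)

  x≈0⇒y*x≈0 : ∀ y {x} → x ≈ 0# → y * x ≈ 0#
  x≈0⇒y*x≈0 y x≈0 = trans (*-congˡ x≈0) (zeroʳ y)

  x≈0⇒x*y≈0 : ∀ y {x} → x ≈ 0# → x * y ≈ 0#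
  x≈0⇒x*y≈0 y x≈0 = trans (*-congʳ x≈0) (zeroˡ y)

  +-≈0 : ∀ {x y} → x ≈ 0# → y ≈ 0# → x + y ≈ 0#
  +-≈0 x≈0 y≈0 = trans (+-cong x≈0 y≈0) (+-identityʳ 0#)

  +-≈0-cancelˡ : ∀ {x y} → x + y ≈ 0# → x ≈ 0# → y ≈ 0#
  +-≈0-cancelˡ {x} {y} x+y≈0 x≈0 = begin
    y        ≈⟨ +-identityˡ y ⟨
    0# + y   ≈⟨ +-congʳ x≈0 ⟨
    x + y    ≈⟨ x+y≈0 ⟩
    0#       ∎

  +-≈0-cancelʳ : ∀ {x y} → x + y ≈ 0# → y ≈ 0# → x ≈ 0#
  +-≈0-cancelʳ x+y≈0 = +-≈0-cancelˡ (trans (+-comm _ _) x+y≈0)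

  *-cancelˡ-≈0 : ∀ {x y} → x ≉ 0# → x * y ≈ 0# → y ≈ 0#
  *-cancelˡ-≈0 {x} {y} x≉0 xy≈0 = begin
    y               ≈⟨ *-identityˡ y ⟨
    1# * y          ≈⟨ *-congʳ (trans (*-comm x⁻¹ x) (proj₂ (inverse x x≉0))) ⟨
    (x⁻¹ * x) * y   ≈⟨ *-assoc x⁻¹ x y ⟩
    x⁻¹ * (x * y)   ≈⟨ x≈0⇒y*x≈0 x⁻¹ xy≈0 ⟩
    0#              ∎
    where x⁻¹ = proj₁ (inverse x x≉0)

  *-cancelʳ-≈0 : ∀ {x y} → y ≉ 0# → x * y ≈ 0# → x ≈ 0#
  *-cancelʳ-≈0 y≉0 xy≈0 = *-cancelˡ-≈0 y≉0 (trans (*-comm _ _) xy≈0)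

  *-≉0 : ∀ {x y} → x ≉ 0# → y ≉ 0# → x * y ≉ 0#
  *-≉0 x≉0 y≉0 xy≈0 = y≉0 (*-cancelˡ-≈0 x≉0 xy≈0)

  -‿≉0 : ∀ {x} → x ≉ 0# → - x ≉ 0#
  -‿≉0 x≉0 -x≈0 = x≉0 (trans (sym (-‿involutive _)) (trans (-‿cong -x≈0) -0#≈0#))

  x+[y-x]≈y : ∀ x y → x + (y - x) ≈ y
  x+[y-x]≈y = solve 2 (λ x y → x :+ (y :- x) := y) refl

  [y-x]+x≈y : ∀ x y → (y - x) + x ≈ y
  [y-x]+x≈y = solve 2 (λ x y → (y :- x) :+ x := y) refl

  x+y≈z⇒y≈z-x : ∀ {x y z} → x + y ≈ z → y ≈ z - x
  x+y≈z⇒y≈z-x {x} {y} x+y≈z =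
    trans (solve 2 (λ x y → y := (x :+ y) :- x) refl x y) (+-congʳ x+y≈z)

  x+y≈z⇒x≈z-y : ∀ {x y z} → x + y ≈ z → x ≈ z - y
  x+y≈z⇒x≈z-y {x} {y} x+y≈z =
    trans (solve 2 (λ x y → x := (x :+ y) :- y) refl x y) (+-congʳ x+y≈z)

  -- Neighbours in Λ₅

  coordinatewise : ∀ {u v : Vect 5} → u 0F ≈ v 0F → u 1F ≈ v 1F → u 2F ≈ v 2F →
                   u 3F ≈ v 3F → u 4F ≈ v 4F → u 5F ≈ v 5F → u ≋ v
  coordinatewise e₀ e₁ e₂ e₃ e₄ e₅ 0F = e₀
  coordinatewise e₀ e₁ e₂ e₃ e₄ e₅ 1F = e₁
  coordinatewise e₀ e₁ e₂ e₃ e₄ e₅ 2F = e₂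
  coordinatewise e₀ e₁ e₂ e₃ e₄ e₅ 3F = e₃
  coordinatewise e₀ e₁ e₂ e₃ e₄ e₅ 4F = e₄
  coordinatewise e₀ e₁ e₂ e₃ e₄ e₅ 5F = e₅

  module _ {l r : Vect 5} where
    adj₂ : Adj l r → l 2F + r 2F ≈ r 0F * l 0F
    adj₂ l∼r = l∼r 0 (ℕ.<ᵇ⇒< 2 6 _)

    adj₃ : Adj l r → l 3F + r 3F ≈ r 0F * l 1F
    adj₃ l∼r = l∼r 1 (ℕ.<ᵇ⇒< 3 6 _)

    adj₄ : Adj l r → l 4F + r 4F ≈ l 0F * r 2F
    adj₄ l∼r = l∼r 2 (ℕ.<ᵇ⇒< 4 6 _)

    adj₅ : Adj l r → l 5F + r 5F ≈ l 0F * r 3F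
    adj₅ l∼r = l∼r 3 (ℕ.<ᵇ⇒< 5 6 _)

    adjacent : l 2F + r 2F ≈ r 0F * l 0F → l 3F + r 3F ≈ r 0F * l 1F →
               l 4F + r 4F ≈ l 0F * r 2F → l 5F + r 5F ≈ l 0F * r 3F → Adj l r
    adjacent e₂ e₃ e₄ e₅ 0 _ = e₂
    adjacent e₂ e₃ e₄ e₅ 1 _ = e₃
    adjacent e₂ e₃ e₄ e₅ 2 _ = e₄
    adjacent e₂ e₃ e₄ e₅ 3 _ = e₅
    adjacent e₂ e₃ e₄ e₅ (suc (suc (suc (suc _))))
      (ℕ.s≤s (ℕ.s≤s (ℕ.s≤s (ℕ.s≤s (ℕ.s≤s (ℕ.s≤s ()))))))

  Adj-resp-≋ : ∀ {l l' r r'} → Adj l r → l ≋ l' → r ≋ r' → Adj l' r'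
  Adj-resp-≋ l∼r l≋l' r≋r' = adjacent
    (trans (sym (+-cong (l≋l' 2F) (r≋r' 2F))) (trans (adj₂ l∼r) (*-cong (r≋r' 0F) (l≋l' 0F))))
    (trans (sym (+-cong (l≋l' 3F) (r≋r' 3F))) (trans (adj₃ l∼r) (*-cong (r≋r' 0F) (l≋l' 1F))))
    (trans (sym (+-cong (l≋l' 4F) (r≋r' 4F))) (trans (adj₄ l∼r) (*-cong (l≋l' 0F) (r≋r' 2F))))
    (trans (sym (+-cong (l≋l' 5F) (r≋r' 5F))) (trans (adj₅ l∼r) (*-cong (l≋l' 0F) (r≋r' 3F))))

  zero-adjacent : ∀ {r} → r 2F ≈ 0# → r 3F ≈ 0# → r 4F ≈ 0# → r 5F ≈ 0# → Adj zeroV r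
  zero-adjacent r₂≈0 r₃≈0 r₄≈0 r₅≈0 = adjacent
    (trans (+-identityˡ _) (trans r₂≈0 (sym (zeroʳ _))))
    (trans (+-identityˡ _) (trans r₃≈0 (sym (zeroʳ _))))
    (trans (+-identityˡ _) (trans r₄≈0 (sym (zeroˡ _))))
    (trans (+-identityˡ _) (trans r₅≈0 (sym (zeroˡ _))))

  module _ {r : Vect 5} (0∼r : Adj zeroV r) where
    zero-adj₂ : r 2F ≈ 0#
    zero-adj₂ = trans (sym (+-identityˡ _)) (trans (adj₂ 0∼r) (zeroʳ _))

    zero-adj₃ : r 3F ≈ 0#
    zero-adj₃ = trans (sym (+-identityˡ _)) (trans (adj₃ 0∼r) (zeroʳ _))

    zero-adj₄ : r 4F ≈ 0#
    zero-adj₄ = trans (sym (+-identityˡ _)) (trans (adj₄ 0∼r) (zeroˡ _))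

    zero-adj₅ : r 5F ≈ 0#
    zero-adj₅ = trans (sym (+-identityˡ _)) (trans (adj₅ 0∼r) (zeroˡ _))

  rNeighbour-adj : ∀ l y → Adj l (rNeighbour l y)
  rNeighbour-adj l y = adjacent (x+[y-x]≈y _ _) (x+[y-x]≈y _ _) (x+[y-x]≈y _ _) (x+[y-x]≈y _ _)

  lNeighbour-adj : ∀ r x → Adj (lNeighbour r x) r
  lNeighbour-adj r x = adjacent ([y-x]+x≈y _ _) ([y-x]+x≈y _ _) ([y-x]+x≈y _ _) ([y-x]+x≈y _ _)

  rNeighbour-unique : ∀ {l r y} → Adj l r → InR r 2≤5 → r 0F ≈ y → r ≋ rNeighbour l y
  rNeighbour-unique l∼r r₁≈0 r₀≈y = coordinatewise r₀≈y r₁≈0 r₂≈ r₃≈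
      (trans (x+y≈z⇒y≈z-x (adj₄ l∼r)) (+-congʳ (*-congˡ r₂≈)))
      (trans (x+y≈z⇒y≈z-x (adj₅ l∼r)) (+-congʳ (*-congˡ r₃≈)))
    where
    r₂≈ = trans (x+y≈z⇒y≈z-x (adj₂ l∼r)) (+-congʳ (*-congʳ r₀≈y))
    r₃≈ = trans (x+y≈z⇒y≈z-x (adj₃ l∼r)) (+-congʳ (*-congʳ r₀≈y))

  lNeighbour-unique : ∀ {l r x} → Adj l r → InL l 2≤5 → l 0F ≈ x → l ≋ lNeighbour r x
  lNeighbour-unique l∼r l₁≈l₂ l₀≈x = coordinatewise l₀≈x (trans l₁≈l₂ l₂≈) l₂≈
      (trans (x+y≈z⇒x≈z-y (adj₃ l∼r)) (+-congʳ (*-congˡ (trans l₁≈l₂ l₂≈))))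
      (trans (x+y≈z⇒x≈z-y (adj₄ l∼r)) (+-congʳ (*-congʳ l₀≈x)))
      (trans (x+y≈z⇒x≈z-y (adj₅ l∼r)) (+-congʳ (*-congʳ l₀≈x)))
    where
    l₂≈ = trans (x+y≈z⇒x≈z-y (adj₂ l∼r)) (+-congʳ (*-congˡ l₀≈x))

  rNeighbour-cong : ∀ {l l' y y'} → l ≋ l' → y ≈ y' → rNeighbour l y ≋ rNeighbour l' y'
  rNeighbour-cong {l} {y = y} l≋l' y≈y' =
    rNeighbour-unique (Adj-resp-≋ (rNeighbour-adj l y) l≋l' ≋-refl) refl y≈y'

  lNeighbour-cong : ∀ {r r' x x'} → r ≋ r' → x ≈ x' → lNeighbour r x ≋ lNeighbour r' x'
  lNeighbour-cong {r} {x = x} r≋r' x≈x' =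
    lNeighbour-unique (Adj-resp-≋ (lNeighbour-adj r x) ≋-refl r≋r') refl x≈x'

  lNeighbours-apart : ∀ {l l' r} → Adj l r → Adj l' r → InL l 2≤5 → InL l' 2≤5 →
                      ¬ (l ≋ l') → l 0F ≉ l' 0F
  lNeighbours-apart l∼r l'∼r l∈L l'∈L l≉l' l₀≈l'₀ =
    l≉l' (≋-trans (lNeighbour-unique l∼r l∈L l₀≈l'₀) (≋-sym (lNeighbour-unique l'∼r l'∈L refl)))

  rNeighbours-apart : ∀ {l r r'} → Adj l r → Adj l r' → InR r 2≤5 → InR r' 2≤5 →
                      ¬ (r ≋ r') → r 0F ≉ r' 0F
  rNeighbours-apart l∼r l∼r' r∈R r'∈R r≉r' r₀≈r'₀ =
    r≉r' (≋-trans (rNeighbour-unique l∼r r∈R r₀≈r'₀) (≋-sym (rNeighbour-unique l∼r' r'∈R refl)))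

  apart-at : ∀ k {u v : Vect 5} {p} → u k - v k ≈ p → p ≉ 0# → ¬ (u ≋ v)
  apart-at k uₖ-vₖ≈p p≉0 u≋v = ≉-by-difference uₖ-vₖ≈p p≉0 (u≋v k)

  pairwise-apart : ∀ {n} {f : Fin n → Vect 5} → (∀ {i j} → i < j → ¬ (f i ≋ f j)) →
                   ∀ i j → i ≢ j → ¬ (f i ≋ f j)
  pairwise-apart apart i j i≢j with <-cmp i j
  ... | tri< i<j _ _ = apart i<j
  ... | tri≈ _ i≡j _ = contradiction i≡j i≢j
  ... | tri> _ _ j<i = λ fi≋fj → apart j<i (≋-sym fi≋fj)

  -- Identities satisfied by the closing vertex

  closing₃-expansion : ∀ x₂ x₃ x₄ x₅ y₂ y₃ y₄ → closingVertex x₂ x₃ x₄ x₅ y₂ y₃ y₄ 3F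
    ≈ y₃ * ((y₂ - y₃) * (x₄ - x₃)) + y₄ * ((y₂ - y₄) * (x₅ - x₄))
  closing₃-expansion = solve 7 (λ x₂ x₃ x₄ x₅ y₂ y₃ y₄ → P.closingVertex x₂ x₃ x₄ x₅ y₂ y₃ y₄ 3F
    := y₃ :* ((y₂ :- y₃) :* (x₄ :- x₃)) :+ y₄ :* ((y₂ :- y₄) :* (x₅ :- x₄))) refl

  closing-certifies-y₂≈y₃+y₄ : ∀ x₂ x₃ x₄ x₅ y₂ y₃ y₄ →
    let C = closingVertex x₂ x₃ x₄ x₅ y₂ y₃ y₄ in
    (x₅ - x₄) * ((x₅ - x₄) * (y₄ * ((y₄ - y₃) * ((y₂ - y₄) * (y₂ - (y₃ + y₄))))))
      ≈ (- (y₃ * (y₂ - y₃)) * C 2F) * C 2F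
        + ((y₂ - y₃) * y₃ * (x₃ + x₄) + y₄ * (y₂ - y₄) * (x₅ - x₄)) * C 3F
        + y₃ * (y₂ - y₃) * y₂ * C 4F
        + - (y₃ * (y₂ - y₃) + y₃ * (y₂ - y₃)) * C 5F
  closing-certifies-y₂≈y₃+y₄ = solve 7 (λ x₂ x₃ x₄ x₅ y₂ y₃ y₄ →
    let C = P.closingVertex x₂ x₃ x₄ x₅ y₂ y₃ y₄ in
    (x₅ :- x₄) :* ((x₅ :- x₄) :* (y₄ :* ((y₄ :- y₃) :* ((y₂ :- y₄) :* (y₂ :- (y₃ :+ y₄))))))
      := (:- (y₃ :* (y₂ :- y₃)) :* C 2F) :* C 2F
        :+ ((y₂ :- y₃) :* y₃ :* (x₃ :+ x₄) :+ y₄ :* (y₂ :- y₄) :* (x₅ :- x₄)) :* C 3F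
        :+ y₃ :* (y₂ :- y₃) :* y₂ :* C 4F
        :+ :- (y₃ :* (y₂ :- y₃) :+ y₃ :* (y₂ :- y₃)) :* C 5F) refl

  closing-certifies-x₅≈x₃ : ∀ x₂ x₃ x₄ x₅ y₃ y₄ →
    closingVertex x₂ x₃ x₄ x₅ (y₃ + y₄) y₃ y₄ 3F ≈ (y₃ * y₄) * (x₅ - x₃)
  closing-certifies-x₅≈x₃ = solve 6 (λ x₂ x₃ x₄ x₅ y₃ y₄ →
    P.closingVertex x₂ x₃ x₄ x₅ (y₃ :+ y₄) y₃ y₄ 3F := (y₃ :* y₄) :* (x₅ :- x₃)) refl

  closing-certifies-x₂-relation : ∀ x₂ x₃ x₄ y₃ y₄ →
    closingVertex x₂ x₃ x₄ x₃ (y₃ + y₄) y₃ y₄ 2F ≈ (y₃ + y₄) * x₂ - (y₃ - y₄) * (x₄ - x₃)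
  closing-certifies-x₂-relation = solve 5 (λ x₂ x₃ x₄ y₃ y₄ →
    P.closingVertex x₂ x₃ x₄ x₃ (y₃ :+ y₄) y₃ y₄ 2F
      := (y₃ :+ y₄) :* x₂ :- (y₃ :- y₄) :* (x₄ :- x₃)) refl

  closing-certifies-x₄-relation : ∀ x₂ x₃ x₄ y₃ y₄ →
    let C = closingVertex x₂ x₃ x₄ x₃ (y₃ + y₄) y₃ y₄ in
    (y₃ - y₄) * ((x₄ - x₃) * (y₃ * x₃ + y₄ * x₄)) ≈ ((y₃ - y₄) * (x₄ - x₃)) * C 2F + (- 1#) * C 5F
  closing-certifies-x₄-relation = solve 5 (λ x₂ x₃ x₄ y₃ y₄ →
    let C = P.closingVertex x₂ x₃ x₄ x₃ (y₃ :+ y₄) y₃ y₄ in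
    (y₃ :- y₄) :* ((x₄ :- x₃) :* (y₃ :* x₃ :+ y₄ :* x₄))
      := ((y₃ :- y₄) :* (x₄ :- x₃)) :* C 2F :+ (:- con (+ 1)) :* C 5F) refl

  -- Rigidity of 10-cycles through the zero edge

  pointwise-cycleCoordinates : ∀ {f : Fin 5 → Carrier} {a₂ a₃ a₄ a₅} → f 0F ≈ 0# →
    f 1F ≈ a₂ → f 2F ≈ a₃ → f 3F ≈ a₄ → f 4F ≈ a₅ → ∀ i → f i ≈ cycleCoordinates a₂ a₃ a₄ a₅ (toℕ i)
  pointwise-cycleCoordinates e₁ e₂ e₃ e₄ e₅ 0F = e₁
  pointwise-cycleCoordinates e₁ e₂ e₃ e₄ e₅ 1F = e₂
  pointwise-cycleCoordinates e₁ e₂ e₃ e₄ e₅ 2F = e₃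
  pointwise-cycleCoordinates e₁ e₂ e₃ e₄ e₅ 3F = e₄
  pointwise-cycleCoordinates e₁ e₂ e₃ e₄ e₅ 4F = e₅

  consecutive-differences-cong : ∀ {f : Fin 5 → Carrier} {a₂ a₃ a₄ a₅} →
    (∀ i → f i ≈ cycleCoordinates a₂ a₃ a₄ a₅ (toℕ i)) →
    ∀ i → ext f 0# (suc (toℕ i)) - f i
          ≈ cycleCoordinates a₂ a₃ a₄ a₅ (suc (toℕ i)) - cycleCoordinates a₂ a₃ a₄ a₅ (toℕ i)
  consecutive-differences-cong f≈ 0F = +-cong (f≈ 1F) (-‿cong (f≈ 0F))
  consecutive-differences-cong f≈ 1F = +-cong (f≈ 2F) (-‿cong (f≈ 1F))
  consecutive-differences-cong f≈ 2F = +-cong (f≈ 3F) (-‿cong (f≈ 2F))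
  consecutive-differences-cong f≈ 3F = +-cong (f≈ 4F) (-‿cong (f≈ 3F))
  consecutive-differences-cong f≈ 4F = +-congˡ (-‿cong (f≈ 4F))

  module TenCycle {ls rs : Fin 5 → Vect 5} (cyc : IsCycle 5 2≤5 4 ls rs) where
    open IsCycle cyc

    closes : ∀ {x₂ x₃ x₄ x₅ y₂ y₃ y₄} →
             ls 1F 0F ≈ x₂ → ls 2F 0F ≈ x₃ → ls 3F 0F ≈ x₄ → ls 4F 0F ≈ x₅ →
             rs 1F 0F ≈ y₂ → rs 2F 0F ≈ y₃ → rs 3F 0F ≈ y₄ → rs 4F 0F ≈ y₂ →
             Adj zeroV (closingVertex x₂ x₃ x₄ x₅ y₂ y₃ y₄)
    closes {x₂} {x₃} {x₄} {x₅} {y₂} {y₃} {y₄} e₂ e₃ e₄ e₅ f₂ f₃ f₄ f₅ =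
      Adj-resp-≋ (adj-rl 4F) l-zero (rs-onPath 4F ls₄-onPath)
      where
      x = cycleCoordinates x₂ x₃ x₄ x₅
      y = cycleCoordinates y₂ y₃ y₄ y₂

      ls≈x : ∀ i → ls i 0F ≈ x (toℕ i)
      ls≈x = pointwise-cycleCoordinates (l-zero 0F) e₂ e₃ e₄ e₅

      rs≈y : ∀ i → rs i 0F ≈ y (toℕ i)
      rs≈y = pointwise-cycleCoordinates (r-zero 0F) f₂ f₃ f₄ f₅

      rs-onPath : ∀ i → ls i ≋ pathL x y (toℕ i) → rs i ≋ pathR x y (toℕ i)
      rs-onPath i ls≋ = ≋-trans (rNeighbour-unique (adj-lr i) (inR i) (rs≈y i)) (rNeighbour-cong ls≋ refl)

      ls-onPath : ∀ j {r r'} → Adj (ls j) r → r ≋ r' → ls j ≋ lNeighbour r' (x (toℕ j))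
      ls-onPath j l∼r r≋r' = ≋-trans (lNeighbour-unique l∼r (inL j) (ls≈x j)) (lNeighbour-cong r≋r' refl)

      ls₁-onPath : ls 1F ≋ pathL x y 1
      ls₁-onPath = ls-onPath 1F (adj-rl 0F) (rs-onPath 0F l-zero)
      ls₂-onPath : ls 2F ≋ pathL x y 2
      ls₂-onPath = ls-onPath 2F (adj-rl 1F) (rs-onPath 1F ls₁-onPath)
      ls₃-onPath : ls 3F ≋ pathL x y 3
      ls₃-onPath = ls-onPath 3F (adj-rl 2F) (rs-onPath 2F ls₂-onPath)
      ls₄-onPath : ls 4F ≋ pathL x y 4
      ls₄-onPath = ls-onPath 4F (adj-rl 3F) (rs-onPath 3F ls₃-onPath)

    x-apart : ∀ {k} i j → i ≢ j → Adj (ls i) (rs k) → Adj (ls j) (rs k) → ls i 0F ≉ ls j 0F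
    x-apart i j i≢j li∼r lj∼r = lNeighbours-apart li∼r lj∼r (inL i) (inL j) (l-dist i j i≢j)

    y-apart : ∀ {k} i j → i ≢ j → Adj (ls k) (rs i) → Adj (ls k) (rs j) → rs i 0F ≉ rs j 0F
    y-apart i j i≢j l∼ri l∼rj = rNeighbours-apart l∼ri l∼rj (inR i) (inR j) (r-dist i j i≢j)

  HasStandardType : (u v : Fin 5 → Carrier) (b c r : Carrier) → Set ℓ
  HasStandardType u v b c r =
    (v 0F ≈ standardV b c 0F) × (v 1F ≈ standardV b c 1F) × (v 2F ≈ standardV b c 2F) ×
    (v 3F ≈ standardV b c 3F) × (v 4F ≈ standardV b c 4F) ×
    (u 0F ≈ standardU b c r 0F) × (u 1F ≈ standardU b c r 1F) × (u 2F ≈ standardU b c r 2F) ×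
    (u 3F ≈ standardU b c r 3F) × (u 4F ≈ standardU b c r 4F)

  pointwise⇒HasStandardType : ∀ {u v b c r} →
    (∀ i → u i ≈ standardU b c r i) → (∀ i → v i ≈ standardV b c i) → HasStandardType u v b c r
  pointwise⇒HasStandardType u≈ v≈ =
    v≈ 0F , v≈ 1F , v≈ 2F , v≈ 3F , v≈ 4F , u≈ 0F , u≈ 1F , u≈ 2F , u≈ 3F , u≈ 4F

  HasStandardType⇒pointwise : ∀ {u v b c r} → HasStandardType u v b c r →
    (∀ i → u i ≈ standardU b c r i) × (∀ i → v i ≈ standardV b c i)
  HasStandardType⇒pointwise (v₀ , v₁ , v₂ , v₃ , v₄ , u₀ , u₁ , u₂ , u₃ , u₄) =
    (λ { 0F → u₀ ; 1F → u₁ ; 2F → u₂ ; 3F → u₃ ; 4F → u₄ }) ,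
    (λ { 0F → v₀ ; 1F → v₁ ; 2F → v₂ ; 3F → v₃ ; 4F → v₄ })

  standardX-differences : ∀ b c r i →
    standardX b c r (suc (toℕ i)) - standardX b c r (toℕ i) ≈ standardU b c r i
  standardX-differences b c r 0F =
    solve 3 (λ b c r → P.standardX b c r 1 :- P.standardX b c r 0 := P.standardU b c r 0F) refl b c r
  standardX-differences b c r 1F =
    solve 3 (λ b c r → P.standardX b c r 2 :- P.standardX b c r 1 := P.standardU b c r 1F) refl b c r
  standardX-differences b c r 2F =
    solve 3 (λ b c r → P.standardX b c r 3 :- P.standardX b c r 2 := P.standardU b c r 2F) refl b c r
  standardX-differences b c r 3F =
    solve 3 (λ b c r → P.standardX b c r 4 :- P.standardX b c r 3 := P.standardU b c r 3F) refl b c r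
  standardX-differences b c r 4F =
    solve 3 (λ b c r → P.standardX b c r 5 :- P.standardX b c r 4 := P.standardU b c r 4F) refl b c r

  standardY-differences : ∀ b c i → standardY b c (suc (toℕ i)) - standardY b c (toℕ i) ≈ standardV b c i
  standardY-differences b c 0F =
    solve 2 (λ b c → P.standardY b c 1 :- P.standardY b c 0 := P.standardV b c 0F) refl b c
  standardY-differences b c 1F =
    solve 2 (λ b c → P.standardY b c 2 :- P.standardY b c 1 := P.standardV b c 1F) refl b c
  standardY-differences b c 2F =
    solve 2 (λ b c → P.standardY b c 3 :- P.standardY b c 2 := P.standardV b c 2F) refl b c
  standardY-differences b c 3F =
    solve 2 (λ b c → P.standardY b c 4 :- P.standardY b c 3 := P.standardV b c 3F) refl b c
  standardY-differences b c 4F =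
    solve 2 (λ b c → P.standardY b c 5 :- P.standardY b c 4 := P.standardV b c 4F) refl b c

  -- Cycles with v₁ + v₅ = 0 are standard

  module StandardShape {u v : Fin 5 → Carrier} {ls rs : Fin 5 → Vect 5}
    (cyc : IsCycle 5 2≤5 4 ls rs)
    (hu : ∀ i → u i ≈ ext (λ j → ls j 0F) 0# (suc (toℕ i)) - ls i 0F)
    (hv : ∀ i → v i ≈ ext (λ j → rs j 0F) 0# (suc (toℕ i)) - rs i 0F)
    (v₀+v₄≈0 : v 0F + v 4F ≈ 0#) where
    open IsCycle cyc
    open TenCycle cyc

    x₂ x₃ x₄ x₅ y₂ y₃ y₄ : Carrier
    x₂ = ls 1F 0F
    x₃ = ls 2F 0F
    x₄ = ls 3F 0F
    x₅ = ls 4F 0F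
    y₂ = rs 1F 0F
    y₃ = rs 2F 0F
    y₄ = rs 3F 0F

    y₅≈y₂ : rs 4F 0F ≈ y₂
    y₅≈y₂ = ≈-by-difference
      (solve 3 (λ y₁ y₂ y₅ →
         y₅ :- y₂ := (:- con (+ 1)) :* ((y₂ :- y₁) :+ (con (+ 0) :- y₅)) :+ (:- con (+ 1)) :* y₁)
         refl (rs 0F 0F) y₂ (rs 4F 0F))
      (+-≈0 (x≈0⇒y*x≈0 _ (trans (sym (+-cong (hv 0F) (hv 4F))) v₀+v₄≈0)) (x≈0⇒y*x≈0 _ (r-zero 0F)))

    x₅≉0 : x₅ ≉ 0#
    x₅≉0 x₅≈0 = x-apart 4F 0F (λ ()) (adj-lr 4F) (adj-rl 4F) (trans x₅≈0 (sym (l-zero 0F)))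

    y₂≉0 : y₂ ≉ 0#
    y₂≉0 y₂≈0 = y-apart 0F 1F (λ ()) (adj-rl 0F) (adj-lr 1F) (trans (r-zero 0F) (sym y₂≈0))

    x₄-x₃≉0 : x₄ - x₃ ≉ 0#
    x₄-x₃≉0 = x≉y⇒x-y≉0 (x-apart 3F 2F (λ ()) (adj-rl 2F) (adj-lr 2F))

    x₅-x₄≉0 : x₅ - x₄ ≉ 0#
    x₅-x₄≉0 = x≉y⇒x-y≉0 (x-apart 4F 3F (λ ()) (adj-rl 3F) (adj-lr 3F))

    y₂-y₃≉0 : y₂ - y₃ ≉ 0#
    y₂-y₃≉0 = x≉y⇒x-y≉0 (y-apart 1F 2F (λ ()) (adj-rl 1F) (adj-lr 2F))

    y₃-y₄≉0 : y₃ - y₄ ≉ 0#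
    y₃-y₄≉0 = x≉y⇒x-y≉0 (y-apart 2F 3F (λ ()) (adj-rl 2F) (adj-lr 3F))

    y₄-y₃≉0 : y₄ - y₃ ≉ 0#
    y₄-y₃≉0 = x≉y⇒x-y≉0 (y-apart 3F 2F (λ ()) (adj-lr 3F) (adj-rl 2F))

    y₂-y₄≉0 : y₂ - y₄ ≉ 0#
    y₂-y₄≉0 = x≉y⇒x-y≉0 λ y₂≈y₄ →
      y-apart 4F 3F (λ ()) (adj-lr 4F) (adj-rl 3F) (trans y₅≈y₂ y₂≈y₄)

    closes-up : Adj zeroV (closingVertex x₂ x₃ x₄ x₅ y₂ y₃ y₄)
    closes-up = closes refl refl refl refl refl refl refl y₅≈y₂

    closes-up₃ : y₃ * ((y₂ - y₃) * (x₄ - x₃)) + y₄ * ((y₂ - y₄) * (x₅ - x₄)) ≈ 0#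
    closes-up₃ = trans (sym (closing₃-expansion x₂ x₃ x₄ x₅ y₂ y₃ y₄)) (zero-adj₃ closes-up)

    y₃≉0 : y₃ ≉ 0#
    y₃≉0 y₃≈0 = y₃-y₄≉0 (x≈y⇒x-y≈0 (trans y₃≈0 (sym y₄≈0)))
      where
      y₄≈0 = *-cancelʳ-≈0 (*-≉0 y₂-y₄≉0 x₅-x₄≉0) (+-≈0-cancelˡ closes-up₃ (x≈0⇒x*y≈0 _ y₃≈0))

    y₄≉0 : y₄ ≉ 0#
    y₄≉0 y₄≈0 = y₃-y₄≉0 (x≈y⇒x-y≈0 (trans y₃≈0 (sym y₄≈0)))
      where
      y₃≈0 = *-cancelʳ-≈0 (*-≉0 y₂-y₃≉0 x₄-x₃≉0) (+-≈0-cancelʳ closes-up₃ (x≈0⇒x*y≈0 _ y₄≈0))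

    y₂≈y₃+y₄ : y₂ ≈ y₃ + y₄
    y₂≈y₃+y₄ = x-y≈0⇒x≈y _ _
      (*-cancelˡ-≈0 y₂-y₄≉0 (*-cancelˡ-≈0 y₄-y₃≉0 (*-cancelˡ-≈0 y₄≉0
        (*-cancelˡ-≈0 x₅-x₄≉0 (*-cancelˡ-≈0 x₅-x₄≉0
          (trans (closing-certifies-y₂≈y₃+y₄ x₂ x₃ x₄ x₅ y₂ y₃ y₄)
            (+-≈0 (+-≈0 (+-≈0 (x≈0⇒y*x≈0 _ (zero-adj₂ closes-up)) (x≈0⇒y*x≈0 _ (zero-adj₃ closes-up)))
                        (x≈0⇒y*x≈0 _ (zero-adj₄ closes-up)))
                  (x≈0⇒y*x≈0 _ (zero-adj₅ closes-up)))))))))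

    y₃+y₄≉0 : y₃ + y₄ ≉ 0#
    y₃+y₄≉0 y₃+y₄≈0 = y₂≉0 (trans y₂≈y₃+y₄ y₃+y₄≈0)

    y₅≈y₃+y₄ : rs 4F 0F ≈ y₃ + y₄
    y₅≈y₃+y₄ = trans y₅≈y₂ y₂≈y₃+y₄

    x₅≈x₃ : x₅ ≈ x₃
    x₅≈x₃ = x-y≈0⇒x≈y _ _ (*-cancelˡ-≈0 (*-≉0 y₃≉0 y₄≉0)
      (trans (sym (closing-certifies-x₅≈x₃ x₂ x₃ x₄ x₅ y₃ y₄))
             (zero-adj₃ (closes refl refl refl refl y₂≈y₃+y₄ refl refl y₅≈y₃+y₄))))

    -- Walking the cycle again with y₂ = y₃ + y₄ and x₅ = x₃ substituted keeps the remaining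
    -- certificates small.
    closes-up′ : Adj zeroV (closingVertex x₂ x₃ x₄ x₃ (y₃ + y₄) y₃ y₄)
    closes-up′ = closes refl refl refl x₅≈x₃ y₂≈y₃+y₄ refl refl y₅≈y₃+y₄

    x₂-relation : (y₃ + y₄) * x₂ - (y₃ - y₄) * (x₄ - x₃) ≈ 0#
    x₂-relation = trans (sym (closing-certifies-x₂-relation x₂ x₃ x₄ y₃ y₄)) (zero-adj₂ closes-up′)

    x₄-relation : y₃ * x₃ + y₄ * x₄ ≈ 0#
    x₄-relation = *-cancelˡ-≈0 x₄-x₃≉0 (*-cancelˡ-≈0 y₃-y₄≉0
      (trans (closing-certifies-x₄-relation x₂ x₃ x₄ y₃ y₄)
             (+-≈0 (x≈0⇒y*x≈0 _ (zero-adj₂ closes-up′)) (x≈0⇒y*x≈0 _ (zero-adj₅ closes-up′)))))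

    b c r : Carrier
    b = - y₄
    c = y₄ - y₃
    r = x₅ * proj₁ (inverse y₄ y₄≉0)

    y₄r≈x₅ : y₄ * r ≈ x₅
    y₄r≈x₅ = begin
      y₄ * (x₅ * y₄⁻¹)   ≈⟨ solve 3 (λ x y z → x :* (y :* z) := y :* (x :* z)) refl y₄ x₅ y₄⁻¹ ⟩
      x₅ * (y₄ * y₄⁻¹)   ≈⟨ *-congˡ (proj₂ (inverse y₄ y₄≉0)) ⟩
      x₅ * 1#            ≈⟨ *-identityʳ x₅ ⟩
      x₅                 ∎
      where y₄⁻¹ = proj₁ (inverse y₄ y₄≉0)

    x₅≈-br : x₅ ≈ - (b * r)
    x₅≈-br = trans (sym y₄r≈x₅) (solve 2 (λ y r → y :* r := :- ((:- y) :* r)) refl y₄ r)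

    x₃≈-br : x₃ ≈ - (b * r)
    x₃≈-br = trans (sym x₅≈x₃) x₅≈-br

    x₄≈[b+c]r : x₄ ≈ (b + c) * r
    x₄≈[b+c]r = x-y≈0⇒x≈y _ _ (*-cancelˡ-≈0 y₄≉0 (trans
      (solve 5 (λ y₃ y₄ x₃ x₄ r →
         y₄ :* (x₄ :- ((:- y₄) :+ (y₄ :- y₃)) :* r)
           := (y₃ :* x₃ :+ y₄ :* x₄) :+ (:- y₃) :* (x₃ :- (:- ((:- y₄) :* r)))) refl y₃ y₄ x₃ x₄ r)
      (+-≈0 x₄-relation (x≈0⇒y*x≈0 _ (x≈y⇒x-y≈0 x₃≈-br)))))

    x₂≈cr : x₂ ≈ c * r
    x₂≈cr = x-y≈0⇒x≈y _ _ (*-cancelˡ-≈0 y₃+y₄≉0 (trans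
      (solve 6 (λ y₃ y₄ x₂ x₃ x₄ r →
         (y₃ :+ y₄) :* (x₂ :- (y₄ :- y₃) :* r)
           := ((y₃ :+ y₄) :* x₂ :- (y₃ :- y₄) :* (x₄ :- x₃))
              :+ (y₃ :- y₄) :* ((x₄ :- ((:- y₄) :+ (y₄ :- y₃)) :* r) :- (x₃ :- (:- ((:- y₄) :* r)))))
         refl y₃ y₄ x₂ x₃ x₄ r)
      (+-≈0 x₂-relation (x≈0⇒y*x≈0 _
        (trans (+-cong (x≈y⇒x-y≈0 x₄≈[b+c]r) (-‿cong (x≈y⇒x-y≈0 x₃≈-br))) (trans (+-identityˡ _) -0#≈0#))))))

    x-standard : ∀ i → ls i 0F ≈ standardX b c r (toℕ i)
    x-standard = pointwise-cycleCoordinates (l-zero 0F) x₂≈cr x₃≈-br x₄≈[b+c]r x₅≈-br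

    y-standard : ∀ i → rs i 0F ≈ standardY b c (toℕ i)
    y-standard = pointwise-cycleCoordinates (r-zero 0F) y₂≈ y₃≈ y₄≈ (trans y₅≈y₂ y₂≈)
      where
      y₂≈ = trans y₂≈y₃+y₄
        (solve 2 (λ y₃ y₄ → y₃ :+ y₄ := :- ((:- y₄) :+ (:- y₄)) :- (y₄ :- y₃)) refl y₃ y₄)
      y₃≈ = solve 2 (λ y₃ y₄ → y₃ := :- (:- y₄) :- (y₄ :- y₃)) refl y₃ y₄
      y₄≈ = solve 1 (λ y₄ → y₄ := :- (:- y₄)) refl y₄

    b≉0 : b ≉ 0#
    b≉0 = -‿≉0 y₄≉0

    c≉0 : c ≉ 0#
    c≉0 = y₄-y₃≉0

    r≉0 : r ≉ 0#
    r≉0 r≈0 = x₅≉0 (trans (sym y₄r≈x₅) (x≈0⇒y*x≈0 y₄ r≈0))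

    c≉-b : c ≉ - b
    c≉-b = ≉-by-difference
      (solve 2 (λ y₃ y₄ → (y₄ :- y₃) :- (:- (:- y₄)) := :- y₃) refl y₃ y₄) (-‿≉0 y₃≉0)

    c≉-2b : c ≉ - (b + b)
    c≉-2b = ≉-by-difference
      (solve 2 (λ y₃ y₄ → (y₄ :- y₃) :- (:- ((:- y₄) :+ (:- y₄))) := :- (y₃ :+ y₄)) refl y₃ y₄)
      (-‿≉0 y₃+y₄≉0)

    standard-type : HasStandardType u v b c r
    standard-type = pointwise⇒HasStandardType
      (λ i → trans (hu i)
        (trans (consecutive-differences-cong x-standard i) (standardX-differences b c r i)))
      (λ i → trans (hv i)
        (trans (consecutive-differences-cong y-standard i) (standardY-differences b c i)))

  -- The standard cycle

  pathL-InL : ∀ x y n → InL (pathL x y n) 2≤5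
  pathL-InL x y zero    = refl
  pathL-InL x y (suc n) = refl

  module StandardCycle (b c r : Carrier) (b≉0 : b ≉ 0#) (c≉0 : c ≉ 0#) (r≉0 : r ≉ 0#)
                       (c≉-b : c ≉ - b) (c≉-2b : c ≉ - (b + b)) where

    ls rs : Fin 5 → Vect 5
    ls i = pathL (standardX b c r) (standardY b c) (toℕ i)
    rs i = pathR (standardX b c r) (standardY b c) (toℕ i)

    b+c≉0 : b + c ≉ 0#
    b+c≉0 b+c≈0 =
      c≉-b (≈-by-difference (solve 2 (λ b c → c :- (:- b) := b :+ c) refl b c) b+c≈0)

    2b+c≉0 : (b + b) + c ≉ 0#
    2b+c≉0 2b+c≈0 =
      c≉-2b (≈-by-difference (solve 2 (λ b c → c :- (:- (b :+ b)) := (b :+ b) :+ c) refl b c) 2b+c≈0)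

    br≉0 : b * r ≉ 0#
    br≉0 = *-≉0 b≉0 r≉0

    cr≉0 : c * r ≉ 0#
    cr≉0 = *-≉0 c≉0 r≉0

    [b+c]r≉0 : (b + c) * r ≉ 0#
    [b+c]r≉0 = *-≉0 b+c≉0 r≉0

    [2b+c]r≉0 : ((b + b) + c) * r ≉ 0#
    [2b+c]r≉0 = *-≉0 2b+c≉0 r≉0

    [2b+c]cr≉0 : ((b + b) + c) * (c * r) ≉ 0#
    [2b+c]cr≉0 = *-≉0 2b+c≉0 cr≉0

    -- [l⁽³⁾] and [l⁽⁵⁾] have the same 0-coordinate, and so do ⟨r⁽²⁾⟩ and ⟨r⁽⁵⁾⟩; these two pairs
    -- are told apart by another coordinate.
    ls-apart : ∀ {i j} → i < j → ¬ (ls i ≋ ls j)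
    ls-apart {0F} {1F} _ = apart-at 0F
      (solve 3 (λ b c r → P.standardX b c r 0 :- P.standardX b c r 1 := :- (c :* r)) refl b c r)
      (-‿≉0 cr≉0)
    ls-apart {0F} {2F} _ = apart-at 0F
      (solve 3 (λ b c r → P.standardX b c r 0 :- P.standardX b c r 2 := b :* r) refl b c r) br≉0
    ls-apart {0F} {3F} _ = apart-at 0F
      (solve 3 (λ b c r → P.standardX b c r 0 :- P.standardX b c r 3 := :- ((b :+ c) :* r)) refl b c r)
      (-‿≉0 [b+c]r≉0)
    ls-apart {0F} {4F} _ = apart-at 0F
      (solve 3 (λ b c r → P.standardX b c r 0 :- P.standardX b c r 4 := b :* r) refl b c r) br≉0
    ls-apart {1F} {2F} _ = apart-at 0F
      (solve 3 (λ b c r → P.standardX b c r 1 :- P.standardX b c r 2 := (b :+ c) :* r) refl b c r)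
      [b+c]r≉0
    ls-apart {1F} {3F} _ = apart-at 0F
      (solve 3 (λ b c r → P.standardX b c r 1 :- P.standardX b c r 3 := :- (b :* r)) refl b c r)
      (-‿≉0 br≉0)
    ls-apart {1F} {4F} _ = apart-at 0F
      (solve 3 (λ b c r → P.standardX b c r 1 :- P.standardX b c r 4 := (b :+ c) :* r) refl b c r)
      [b+c]r≉0
    ls-apart {2F} {3F} _ = apart-at 0F
      (solve 3 (λ b c r → P.standardX b c r 2 :- P.standardX b c r 3 := :- (((b :+ b) :+ c) :* r)) refl b c r)
      (-‿≉0 [2b+c]r≉0)
    ls-apart {2F} {4F} _ = apart-at 1F
      (solve 3 (λ b c r → let ℓ = P.pathL (P.standardX b c r) (P.standardY b c) in
                           ℓ 2 1F :- ℓ 4 1F := ((b :+ b) :+ c) :* (c :* r)) refl b c r)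
      [2b+c]cr≉0
    ls-apart {3F} {4F} _ = apart-at 0F
      (solve 3 (λ b c r → P.standardX b c r 3 :- P.standardX b c r 4 := ((b :+ b) :+ c) :* r) refl b c r)
      [2b+c]r≉0
    ls-apart {_} {0F} ()
    ls-apart {Fin.suc _} {1F} (ℕ.s≤s ())
    ls-apart {Fin.suc (Fin.suc _)} {2F} (ℕ.s≤s (ℕ.s≤s ()))
    ls-apart {Fin.suc (Fin.suc (Fin.suc _))} {3F} (ℕ.s≤s (ℕ.s≤s (ℕ.s≤s ())))
    ls-apart {Fin.suc (Fin.suc (Fin.suc (Fin.suc _)))} {4F} (ℕ.s≤s (ℕ.s≤s (ℕ.s≤s (ℕ.s≤s ()))))

    rs-apart : ∀ {i j} → i < j → ¬ (rs i ≋ rs j)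
    rs-apart {0F} {1F} _ = apart-at 0F
      (solve 2 (λ b c → P.standardY b c 0 :- P.standardY b c 1 := (b :+ b) :+ c) refl b c) 2b+c≉0
    rs-apart {0F} {2F} _ = apart-at 0F
      (solve 2 (λ b c → P.standardY b c 0 :- P.standardY b c 2 := b :+ c) refl b c) b+c≉0
    rs-apart {0F} {3F} _ = apart-at 0F
      (solve 2 (λ b c → P.standardY b c 0 :- P.standardY b c 3 := b) refl b c) b≉0
    rs-apart {0F} {4F} _ = apart-at 0F
      (solve 2 (λ b c → P.standardY b c 0 :- P.standardY b c 4 := (b :+ b) :+ c) refl b c) 2b+c≉0
    rs-apart {1F} {2F} _ = apart-at 0F
      (solve 2 (λ b c → P.standardY b c 1 :- P.standardY b c 2 := :- b) refl b c) (-‿≉0 b≉0)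
    rs-apart {1F} {3F} _ = apart-at 0F
      (solve 2 (λ b c → P.standardY b c 1 :- P.standardY b c 3 := :- (b :+ c)) refl b c) (-‿≉0 b+c≉0)
    rs-apart {1F} {4F} _ = apart-at 2F
      (solve 3 (λ b c r → let ρ = P.pathR (P.standardX b c r) (P.standardY b c) in
                           ρ 1 2F :- ρ 4 2F := :- (((b :+ b) :+ c) :* (c :* r))) refl b c r)
      (-‿≉0 [2b+c]cr≉0)
    rs-apart {2F} {3F} _ = apart-at 0F
      (solve 2 (λ b c → P.standardY b c 2 :- P.standardY b c 3 := :- c) refl b c) (-‿≉0 c≉0)
    rs-apart {2F} {4F} _ = apart-at 0F
      (solve 2 (λ b c → P.standardY b c 2 :- P.standardY b c 4 := b) refl b c) b≉0
    rs-apart {3F} {4F} _ = apart-at 0F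
      (solve 2 (λ b c → P.standardY b c 3 :- P.standardY b c 4 := b :+ c) refl b c) b+c≉0
    rs-apart {_} {0F} ()
    rs-apart {Fin.suc _} {1F} (ℕ.s≤s ())
    rs-apart {Fin.suc (Fin.suc _)} {2F} (ℕ.s≤s (ℕ.s≤s ()))
    rs-apart {Fin.suc (Fin.suc (Fin.suc _))} {3F} (ℕ.s≤s (ℕ.s≤s (ℕ.s≤s ())))
    rs-apart {Fin.suc (Fin.suc (Fin.suc (Fin.suc _)))} {4F} (ℕ.s≤s (ℕ.s≤s (ℕ.s≤s (ℕ.s≤s ()))))

    closes-up : Adj zeroV (rs 4F)
    closes-up = zero-adjacent
      (solve 3 (λ b c r → P.pathR (P.standardX b c r) (P.standardY b c) 4 2F := con (+ 0)) refl b c r)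
      (solve 3 (λ b c r → P.pathR (P.standardX b c r) (P.standardY b c) 4 3F := con (+ 0)) refl b c r)
      (solve 3 (λ b c r → P.pathR (P.standardX b c r) (P.standardY b c) 4 4F := con (+ 0)) refl b c r)
      (solve 3 (λ b c r → P.pathR (P.standardX b c r) (P.standardY b c) 4 5F := con (+ 0)) refl b c r)

    isCycle : IsCycle 5 2≤5 4 ls rs
    isCycle = record
      { inL    = λ i → pathL-InL _ _ (toℕ i)
      ; inR    = λ _ → refl
      ; l-zero = λ _ → refl
      ; r-zero = ≋-sym (rNeighbour-unique (zero-adjacent refl refl refl refl) refl refl)
      ; l-dist = pairwise-apart ls-apart
      ; r-dist = pairwise-apart rs-apart
      ; adj-lr = λ i → rNeighbour-adj _ _
      ; adj-rl = λ { 0F → lNeighbour-adj _ _ ; 1F → lNeighbour-adj _ _ ; 2F → lNeighbour-adj _ _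
                   ; 3F → lNeighbour-adj _ _ ; 4F → closes-up }
      }

    ls≈standardX : ∀ i → ls i 0F ≈ standardX b c r (toℕ i)
    ls≈standardX i = pathL₀ (toℕ i)
      where
      pathL₀ : ∀ n → pathL (standardX b c r) (standardY b c) n 0F ≈ standardX b c r n
      pathL₀ zero    = refl
      pathL₀ (suc n) = refl

    hasCycleOfType : ∀ {u v} → HasStandardType u v b c r → HasCycleOfType 5 2≤5 4 u v
    hasCycleOfType type = ls , rs , isCycle
      , (λ i → trans (proj₁ pointwise i)
          (sym (trans (consecutive-differences-cong ls≈standardX i) (standardX-differences b c r i))))
      , (λ i → trans (proj₂ pointwise i)
          (sym (trans (consecutive-differences-cong (λ _ → refl) i) (standardY-differences b c i))))
      where pointwise = HasStandardType⇒pointwise type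

    v₀+v₄≈0 : ∀ {u v} → HasStandardType u v b c r → v 0F + v 4F ≈ 0#
    v₀+v₄≈0 {u} {v} type = trans (+-cong (proj₂ pointwise 0F) (proj₂ pointwise 4F))
      (solve 2 (λ b c → :- (b :+ b) :- c :+ ((b :+ b) :+ c) := con (+ 0)) refl b c)
      where pointwise = HasStandardType⇒pointwise {u} {v} type

lemma2 : ∀ {a ℓ} (F : FiniteField a ℓ) →
    let open FiniteField F
        open Lambda F
    in ∀ (u v : Fin 5 → Carrier) →
       (HasCycleOfType 5 2≤5 4 u v × (v (# 0) + v (# 4) ≈ 0#))
       ⇔
       (Σ Carrier λ b → Σ Carrier λ c → Σ Carrier λ r →
          ¬ (b ≈ 0#) × ¬ (c ≈ 0#) × ¬ (r ≈ 0#) ×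
          ¬ (c ≈ - b) × ¬ (c ≈ - (b + b)) ×
          (v (# 0) ≈ - (b + b) - c) × (v (# 1) ≈ b) × (v (# 2) ≈ c) ×
          (v (# 3) ≈ - b - c) × (v (# 4) ≈ (b + b) + c) ×
          (u (# 0) ≈ c * r) × (u (# 1) ≈ - ((b + c) * r)) ×
          (u (# 2) ≈ ((b + b) + c) * r) × (u (# 3) ≈ - (((b + b) + c) * r)) ×
          (u (# 4) ≈ b * r))
lemma2 F u v = mk⇔
  (λ ((ls , rs , cyc , hu , hv) , v₀+v₄≈0) →
    let open Λ₅.StandardShape F {u} {v} cyc hu hv v₀+v₄≈0
    in b , c , r , b≉0 , c≉0 , r≉0 , c≉-b , c≉-2b , standard-type)
  (λ (b , c , r , b≉0 , c≉0 , r≉0 , c≉-b , c≉-2b , type) →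
    let open Λ₅.StandardCycle F b c r b≉0 c≉0 r≉0 c≉-b c≉-2b
    in hasCycleOfType {u} {v} type , v₀+v₄≈0 {u} {v} type)
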